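{- Let $X$ be a finite set with $n>1$ elements, let $\mathbf{WO}$ be the set of weak orders on $X$, and let $G$ be the undirected graph with vertex set $\mathbf{WO}$ in which $W,W'$ are adjacent iff one covers the other in the inclusion order on $\mathbf{WO}$. For $W\in\mathbf{WO}$ let $J_W$ be the set of weak $2$-orders $U$ on $X$ with $W\subseteq U$. Then for all $W,W'\in\mathbf{WO}$ the graph distance between $W$ and $W'$ in $G$ equals $|J_W\,\triangle\, J_{W'}|$; that is, $W\mapsto \chi(J_W)\in\{0,1\}^{\mathbf{WO}(2)}$ (characteristic vector) is an isometric embedding of $G$ into the hypercube graph on $\{0,1\}^{2^n-2}$, so $G$ is a partial cube.
   Context: A weak order on $X$ is a transitive, strongly complete binary relation on $X$ (for all $x,y$, $(x,y)\in W$ or $(y,x)\in W$). A weak $2$-order is a weak order with exactly two indifference classes (classes of $W\cap W^{ -1}$); there are $2^n-2$ of them, forming the set $\mathbf{WO}(2)$. The hypercube graph on $\{0,1\}^d$ joins two vectors iff they differ in exactly one coordinate. -}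

module Defs where

open import Data.Nat using (ℕ; zero; suc; _≤_)
open import Data.Bool using (Bool; true; false)
open import Data.Fin using (Fin)
open import Data.Vec using (Vec; lookup)
open import Data.List using (List; length)
open import Data.List.Membership.Propositional using (_∈_)
open import Data.List.Relation.Unary.Unique.Propositional using (Unique)
open import Data.Product using (Σ; ∃; _×_)
open import Data.Sum using (_⊎_)
open import Relation.Binary.PropositionalEquality using (_≡_; _≢_)
open import Relation.Nullary using (¬_)
open import Function.Bundles using (_⇔_)

-- A binary relation on X = Fin n, as its Boolean incidence matrix
-- (so that propositional equality of relations is the right notion).
BRel : ℕ → Set
BRel n = Vec (Vec Bool n) n

_∋⟨_,_⟩ : ∀ {n} → BRel n → Fin n → Fin n → Set
R ∋⟨ x , y ⟩ = lookup (lookup R x) y ≡ true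

_⊆ᴿ_ : ∀ {n} → BRel n → BRel n → Set
R ⊆ᴿ S = ∀ x y → R ∋⟨ x , y ⟩ → S ∋⟨ x , y ⟩

IsWeakOrder : ∀ {n} → BRel n → Set
IsWeakOrder R =
  (∀ x y z → R ∋⟨ x , y ⟩ → R ∋⟨ y , z ⟩ → R ∋⟨ x , z ⟩) ×
  (∀ x y → R ∋⟨ x , y ⟩ ⊎ R ∋⟨ y , x ⟩)

Indiff : ∀ {n} → BRel n → Fin n → Fin n → Set
Indiff R x y = R ∋⟨ x , y ⟩ × R ∋⟨ y , x ⟩

HasTwoIndiffClasses : ∀ {n} → BRel n → Set
HasTwoIndiffClasses R =
  Σ _ λ a → Σ _ λ b → ¬ Indiff R a b × (∀ z → Indiff R z a ⊎ Indiff R z b)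

IsWeak2Order : ∀ {n} → BRel n → Set
IsWeak2Order R = IsWeakOrder R × HasTwoIndiffClasses R

Covers : ∀ {n} → BRel n → BRel n → Set
Covers V W =
  (W ⊆ᴿ V) × (W ≢ V) ×
  (∀ U → IsWeakOrder U → W ⊆ᴿ U → U ⊆ᴿ V → (U ≡ W) ⊎ (U ≡ V))

Adj : ∀ {n} → BRel n → BRel n → Set
Adj W V = IsWeakOrder W × IsWeakOrder V × (Covers V W ⊎ Covers W V)

data Walk {n : ℕ} : BRel n → BRel n → ℕ → Set where
  [] : ∀ {W} → Walk W W 0
  _∷_ : ∀ {W V W' k} → Adj W V → Walk V W' k → Walk W W' (suc k)

IsDistance : ∀ {n} → BRel n → BRel n → ℕ → Set
IsDistance W W' d = Walk W W' d × (∀ k → Walk W W' k → d ≤ k)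

HasCard : ∀ {n} → (BRel n → Set) → ℕ → Set
HasCard P k = ∃ λ (L : List (BRel _)) → Unique L × (∀ U → (U ∈ L) ⇔ P U) × length L ≡ k

-- J_W = { U ∈ WO(2) | W ⊆ U };  U ∈ J_W △ J_W'
InSymDiffJ : ∀ {n} → BRel n → BRel n → BRel n → Set
InSymDiffJ W W' U =
  IsWeak2Order U × ((W ⊆ᴿ U × ¬ (W' ⊆ᴿ U)) ⊎ (W' ⊆ᴿ U × ¬ (W ⊆ᴿ U)))

{-# OPTIONS --safe #-}
module Submission where

-- A weak order W is the intersection of the weak 2-orders containing it (for ¬ W x y, cutting W
-- at y gives one that omits (x , y)), so J W determines W and inclusion of weak orders is reverse
-- inclusion of their J-sets. The edges of G change J by exactly one cut: if V covers W then
-- J V = J W ∖ {u} for a single u. Conversely every u ∈ J W can be removed, by taking V to be the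
-- intersection of J W ∖ {u}, and a u ∈ J W' ∖ J W can be added whenever J W ⊆ J W', by taking
-- V = W ∩ u. Hence |J W △ J W'| changes by exactly one along every edge, which bounds the length
-- of every walk from below, and greedily removing and then adding cuts yields a walk of exactly
-- that length.

open import Defs
open import Data.Bool using (true; false)
import Data.Bool as Bool
open import Data.Bool.Properties using (⇔→≡; T-≡)
open import Data.Empty using (⊥; ⊥-elim)
open import Data.Fin using (Fin)
open import Data.Fin.Properties using (all?; any?)
open import Data.List using (List; []; _∷_; [_]; length; filter; allFin; cartesianProductWith)
open import Data.List.Membership.Propositional using (_∈_; lose)
open import Data.List.Membership.Propositional.Properties
  using (∈-filter⁺; ∈-filter⁻; ∈-allFin; ∈-cartesianProductWith⁺)
open import Data.List.Properties using (filter-some; filter-none)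
open import Data.List.Relation.Unary.All as All using (All; []; _∷_)
open import Data.List.Relation.Unary.Any as Any using (Any; here; there)
open import Data.List.Relation.Unary.AllPairs using ([]; _∷_)
open import Data.List.Relation.Unary.Unique.Propositional using (Unique)
open import Data.List.Relation.Unary.Unique.Propositional.Properties
  using (cartesianProductWith⁺; filter⁺)
open import Data.Nat using (ℕ; zero; suc; _<_; _≤_; s≤s)
open import Data.Nat.Properties using (≤-reflexive; ≤-trans; <⇒≢; m<n⇒m≤1+n; suc-injective)
open import Data.Product using (∃; ∃₂; _×_; _,_; proj₁; proj₂)
open import Data.Sum using (_⊎_; inj₁; inj₂; [_,_]′)
import Data.Sum as Sum
open import Data.Vec using (Vec; []; _∷_; lookup; tabulate)
open import Data.Vec.Properties
  using (lookup∘tabulate; tabulate∘lookup; tabulate-cong; ∷-injective; ≡-dec)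
open import Function using (id; _∘_; case_of_)
open import Function.Bundles using (_⇔_; mk⇔; Equivalence)
import Function.Properties.Equivalence as ⇔
open import Relation.Nullary using (¬_; Dec; yes; no)
open import Relation.Nullary.Decidable
  using (_×-dec_; _⊎-dec_; _→-dec_; ¬?; decidable-stable; toWitness; fromWitness; isYes; map′)
open import Relation.Unary using (Decidable)
open import Relation.Binary.PropositionalEquality as ≡
  using (_≡_; _≢_; refl; sym; cong; subst; module ≡-Reasoning)

lookup-ext : ∀ {A : Set} {m} (u v : Vec A m) → (∀ i → lookup u i ≡ lookup v i) → u ≡ v
lookup-ext u v u≗v = begin
  u                   ≡⟨ tabulate∘lookup u ⟨
  tabulate (lookup u) ≡⟨ tabulate-cong u≗v ⟩
  tabulate (lookup v) ≡⟨ tabulate∘lookup v ⟩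
  v                   ∎
  where open ≡-Reasoning

module _ {A : Set} where

  allVecs : List A → (m : ℕ) → List (Vec A m)
  allVecs xs zero    = [ [] ]
  allVecs xs (suc m) = cartesianProductWith _∷_ xs (allVecs xs m)

  ∈-allVecs : ∀ {xs} → (∀ x → x ∈ xs) → ∀ {m} (v : Vec A m) → v ∈ allVecs xs m
  ∈-allVecs ∈xs []      = here refl
  ∈-allVecs ∈xs (x ∷ v) = ∈-cartesianProductWith⁺ _∷_ (∈xs x) (∈-allVecs ∈xs v)

  allVecs⁺ : ∀ {xs} → Unique xs → ∀ m → Unique (allVecs xs m)
  allVecs⁺ xs! zero    = [] ∷ []
  allVecs⁺ xs! (suc m) = cartesianProductWith⁺ _∷_ ∷-injective xs! (allVecs⁺ xs! m)

module _ {A : Set} {_≼_ : A → A → Set}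
         (≼-trans : ∀ x y z → x ≼ y → y ≼ z → x ≼ z) (≼-total : ∀ x y → x ≼ y ⊎ y ≼ x)
         {P : A → Set} (P? : Decidable P) where

  private
    ≼-refl : ∀ {x} → x ≼ x
    ≼-refl {x} = [ id , id ]′ (≼-total x x)

  least : ∀ xs → Any P xs → ∃ λ m → P m × All (λ z → P z → m ≼ z) xs
  least (x ∷ xs) _ with Any.any? P? xs
  least (x ∷ xs) (here px) | no ∄ =
    x , px , (λ _ → ≼-refl) ∷ All.tabulate λ z∈xs pz → ⊥-elim (∄ (lose z∈xs pz))
  least (x ∷ xs) (there p) | no ∄ = ⊥-elim (∄ p)
  least (x ∷ xs) _         | yes ∃p with least xs ∃p
  ... | m , pm , m≼ with ≼-total m x | P? x
  ...   | inj₁ m≼x | _      = m , pm , (λ _ → m≼x) ∷ m≼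
  ...   | inj₂ x≼m | yes px =
    x , px , (λ _ → ≼-refl) ∷ All.map (λ m≼z pz → ≼-trans x m _ x≼m (m≼z pz)) m≼
  ...   | inj₂ _   | no ¬px = m , pm , (λ px → ⊥-elim (¬px px)) ∷ m≼

leastFin : ∀ {n} {_≼_ : Fin n → Fin n → Set} →
           (∀ x y z → x ≼ y → y ≼ z → x ≼ z) → (∀ x y → x ≼ y ⊎ y ≼ x) →
           ∀ {P} → Decidable P → ∃ P → ∃ λ m → P m × (∀ z → P z → m ≼ z)
leastFin ≼-trans ≼-total P? (x , px) =
  let m , pm , m≼ = least ≼-trans ≼-total P? (allFin _) (lose (∈-allFin x) px)
  in m , pm , λ z → All.lookup m≼ (∈-allFin z)

module _ {A : Set} where

  count : ∀ {P : A → Set} → Decidable P → List A → ℕ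
  count P? xs = length (filter P? xs)

  module _ {P : A → Set} (P? : Decidable P) where

    count≡0⇒¬ : ∀ {xs x} → count P? xs ≡ 0 → x ∈ xs → ¬ P x
    count≡0⇒¬ count≡0 x∈xs px = <⇒≢ (filter-some P? (lose x∈xs px)) (sym count≡0)

    count≡suc⇒∃ : ∀ xs {k} → count P? xs ≡ suc k → ∃ P
    count≡suc⇒∃ xs _ with filter P? xs in filter≡
    ... | y ∷ _ = y , proj₂ (∈-filter⁻ P? {xs = xs} (subst (y ∈_) (sym filter≡) (here refl)))

    count-none : (∀ x → ¬ P x) → ∀ xs → count P? xs ≡ 0
    count-none ¬P xs = cong length (filter-none P? (All.universal ¬P xs))

  module _ {P Q : A → Set} (P? : Decidable P) (Q? : Decidable Q) where

    count-cong : ∀ xs → (∀ {x} → x ∈ xs → P x ⇔ Q x) → count P? xs ≡ count Q? xs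
    count-cong []       P⇔Q = refl
    count-cong (x ∷ xs) P⇔Q with P? x | Q? x
    ... | yes _  | yes _  = cong suc (count-cong xs (P⇔Q ∘ there))
    ... | no  _  | no  _  = count-cong xs (P⇔Q ∘ there)
    ... | yes px | no ¬qx = ⊥-elim (¬qx (Equivalence.to   (P⇔Q (here refl)) px))
    ... | no ¬px | yes qx = ⊥-elim (¬px (Equivalence.from (P⇔Q (here refl)) qx))

    count-toggle : ∀ {xs u} → Unique xs → u ∈ xs → P u → ¬ Q u → (∀ {x} → x ≢ u → P x ⇔ Q x) →
                   count P? xs ≡ suc (count Q? xs)
    count-toggle {x ∷ xs} (x∉xs ∷ _) (here refl) pu ¬qu P⇔Q with P? x | Q? x
    ... | yes _  | no _   = cong suc (count-cong xs λ y∈xs → P⇔Q λ { refl → All.lookup x∉xs y∈xs refl })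
    ... | no ¬pu | _      = ⊥-elim (¬pu pu)
    ... | yes _  | yes qu = ⊥-elim (¬qu qu)
    count-toggle {x ∷ xs} (x∉xs ∷ xs!) (there u∈xs) pu ¬qu P⇔Q
      with ih ← count-toggle xs! u∈xs pu ¬qu P⇔Q | x≢u ← All.lookup x∉xs u∈xs | P? x | Q? x
    ... | yes _  | yes _  = cong suc ih
    ... | no  _  | no  _  = ih
    ... | yes px | no ¬qx = ⊥-elim (¬qx (Equivalence.to   (P⇔Q x≢u) px))
    ... | no ¬px | yes qx = ⊥-elim (¬px (Equivalence.from (P⇔Q x≢u) qx))

variable
  n k : ℕ
  R S U V W W' u : BRel n
  a b c x y : Fin n

_∋?⟨_,_⟩ : (R : BRel n) → ∀ a b → Dec (R ∋⟨ a , b ⟩)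
R ∋?⟨ a , b ⟩ = lookup (lookup R a) b Bool.≟ true

_⊆?_ : (R S : BRel n) → Dec (R ⊆ᴿ S)
R ⊆? S = all? λ a → all? λ b → R ∋?⟨ a , b ⟩ →-dec S ∋?⟨ a , b ⟩

_≟ᴿ_ : (R S : BRel n) → Dec (R ≡ S)
_≟ᴿ_ = ≡-dec (≡-dec Bool._≟_)

⊆-antisym : R ⊆ᴿ S → S ⊆ᴿ R → R ≡ S
⊆-antisym R⊆S S⊆R =
  lookup-ext _ _ λ a → lookup-ext _ _ λ b → ⇔→≡ (mk⇔ (R⊆S a b) (S⊆R a b))

module _ {P : Fin n → Fin n → Set} (P? : ∀ a b → Dec (P a b)) where

  fromPred : BRel n
  fromPred = tabulate λ a → tabulate λ b → isYes (P? a b)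

  private
    lookup-fromPred : lookup (lookup fromPred a) b ≡ isYes (P? a b)
    lookup-fromPred {a} {b} =
      ≡.trans (cong (λ row → lookup row b) (lookup∘tabulate _ a)) (lookup∘tabulate _ b)

  ∋-fromPred⁺ : P a b → fromPred ∋⟨ a , b ⟩
  ∋-fromPred⁺ p = ≡.trans lookup-fromPred (Equivalence.to T-≡ (fromWitness p))

  ∋-fromPred⁻ : fromPred ∋⟨ a , b ⟩ → P a b
  ∋-fromPred⁻ r = toWitness (Equivalence.from T-≡ (≡.trans (sym lookup-fromPred) r))

allRelations : List (BRel n)
allRelations = allVecs (allVecs (true ∷ false ∷ []) _) _

∈-allRelations : (R : BRel n) → R ∈ allRelations
∈-allRelations = ∈-allVecs (∈-allVecs λ { true → here refl ; false → there (here refl) })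

allRelations⁺ : Unique (allRelations {n})
allRelations⁺ = allVecs⁺ (allVecs⁺ (((λ ()) ∷ []) ∷ [] ∷ []) _) _

∃ᴿ? : {P : BRel n → Set} → Decidable P → Dec (∃ P)
∃ᴿ? P? = map′ Any.satisfied (λ (R , p) → lose (∈-allRelations R) p) (Any.any? P? allRelations)

module _ {F : BRel n → Set} (F? : Decidable F) where
  private
    ⋂? = λ a b → All.all? (λ U → F? U →-dec U ∋?⟨ a , b ⟩) allRelations

  ⋂ : BRel n
  ⋂ = fromPred ⋂?

  ∋-⋂⁺ : (∀ {U} → F U → U ∋⟨ a , b ⟩) → ⋂ ∋⟨ a , b ⟩
  ∋-⋂⁺ ∈all = ∋-fromPred⁺ ⋂? (All.tabulate λ _ → ∈all)

  ∋-⋂⁻ : ⋂ ∋⟨ a , b ⟩ → F U → U ∋⟨ a , b ⟩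
  ∋-⋂⁻ {U = U} ∈⋂ = All.lookup (∋-fromPred⁻ ⋂? ∈⋂) (∈-allRelations U)

Transitiveᴿ : BRel n → Set
Transitiveᴿ R = ∀ x y z → R ∋⟨ x , y ⟩ → R ∋⟨ y , z ⟩ → R ∋⟨ x , z ⟩

⋂-transitive : {F : BRel n → Set} (F? : Decidable F) → (∀ {U} → F U → Transitiveᴿ U) → Transitiveᴿ (⋂ F?)
⋂-transitive F? trans a b c ab bc = ∋-⋂⁺ F? λ FU → trans FU a b c (∋-⋂⁻ F? ab FU) (∋-⋂⁻ F? bc FU)

module WeakOrder (R : BRel n) (wR : IsWeakOrder R) where

  trans : R ∋⟨ a , b ⟩ → R ∋⟨ b , c ⟩ → R ∋⟨ a , c ⟩
  trans = proj₁ wR _ _ _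

  total : ∀ a b → R ∋⟨ a , b ⟩ ⊎ R ∋⟨ b , a ⟩
  total = proj₂ wR

  reflexive : R ∋⟨ a , a ⟩
  reflexive {a} = [ id , id ]′ (total a a)

  flip : ¬ R ∋⟨ a , b ⟩ → R ∋⟨ b , a ⟩
  flip {a} {b} ¬ab = [ (λ ab → ⊥-elim (¬ab ab)) , id ]′ (total a b)

  indiff-via : Indiff R a c → Indiff R b c → R ∋⟨ a , b ⟩
  indiff-via (ac , _) (_ , cb) = trans ac cb

transitive⊇weakOrder : (W R : BRel n) → IsWeakOrder W → W ⊆ᴿ R → Transitiveᴿ R → IsWeakOrder R
transitive⊇weakOrder _ _ wW W⊆R R-trans =
  R-trans , λ a b → Sum.map (W⊆R a b) (W⊆R b a) (proj₂ wW a b)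

module Weak2Order (U : BRel n) (u₂ : IsWeak2Order U) where

  open WeakOrder U (proj₁ u₂) public

  private
    a₀ b₀ : Fin n
    a₀ = proj₁ (proj₂ u₂)
    b₀ = proj₁ (proj₂ (proj₂ u₂))

    a₀≁b₀ : ¬ Indiff U a₀ b₀
    a₀≁b₀ = proj₁ (proj₂ (proj₂ (proj₂ u₂)))

    classes : ∀ z → Indiff U z a₀ ⊎ Indiff U z b₀
    classes = proj₂ (proj₂ (proj₂ (proj₂ u₂)))

  no-strict-chain : ¬ U ∋⟨ a , b ⟩ → ¬ U ∋⟨ b , c ⟩ → ⊥
  no-strict-chain {a} {b} {c} ¬ab ¬bc with classes a | classes b | classes c
  ... | inj₁ a~ | inj₁ b~ | _       = ¬ab (indiff-via a~ b~)
  ... | inj₂ a~ | inj₂ b~ | _       = ¬ab (indiff-via a~ b~)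
  ... | _       | inj₁ b~ | inj₁ c~ = ¬bc (indiff-via b~ c~)
  ... | _       | inj₂ b~ | inj₂ c~ = ¬bc (indiff-via b~ c~)
  ... | inj₁ a~ | inj₂ _  | inj₁ c~ = ¬ab (trans (indiff-via a~ c~) (flip ¬bc))
  ... | inj₂ a~ | inj₁ _  | inj₂ c~ = ¬ab (trans (indiff-via a~ c~) (flip ¬bc))

  -- The strict part {(x , y) | ¬ U x y} is a product H × L of the two classes of U.

  strict-swapˡ : ¬ U ∋⟨ x , y ⟩ → ¬ U ∋⟨ a , b ⟩ → ¬ U ∋⟨ a , y ⟩
  strict-swapˡ ¬xy ¬ab ay = no-strict-chain ¬xy λ yb → ¬ab (trans ay yb)

  strict-swapʳ : ¬ U ∋⟨ x , y ⟩ → ¬ U ∋⟨ a , b ⟩ → ¬ U ∋⟨ x , b ⟩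
  strict-swapʳ ¬xy ¬ab xb = no-strict-chain ¬ab λ by → ¬xy (trans xb by)

  strict-combine : ¬ U ∋⟨ a , y ⟩ → ¬ U ∋⟨ x , b ⟩ → ¬ U ∋⟨ a , b ⟩
  strict-combine ¬ay ¬xb ab = no-strict-chain (λ xa → ¬xb (trans xa ab)) ¬ay

  strictPair : ∃₂ λ x y → ¬ U ∋⟨ x , y ⟩
  strictPair with U ∋?⟨ a₀ , b₀ ⟩
  ... | yes ab = b₀ , a₀ , λ ba → a₀≁b₀ (ab , ba)
  ... | no ¬ab = a₀ , b₀ , ¬ab

  maximal : IsWeakOrder R → ¬ R ∋⟨ x , y ⟩ → U ⊆ᴿ R → U ≡ R
  maximal {R = R} {x} {y} wR ¬Rxy U⊆R = ⊆-antisym U⊆R R⊆U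
    where
      module R = WeakOrder R wR

      ¬Uxy : ¬ U ∋⟨ x , y ⟩
      ¬Uxy = ¬Rxy ∘ U⊆R x y

      R⊆U : R ⊆ᴿ U
      R⊆U a b Rab = decidable-stable (U ∋?⟨ a , b ⟩) λ ¬Uab →
        let Uxa = decidable-stable (U ∋?⟨ x , a ⟩) λ ¬Uxa → no-strict-chain ¬Uxa (strict-swapˡ ¬Uxy ¬Uab)
            Uby = decidable-stable (U ∋?⟨ b , y ⟩) λ ¬Uby → no-strict-chain (strict-swapʳ ¬Uxy ¬Uab) ¬Uby
        in ¬Rxy (R.trans (R.trans (U⊆R x a Uxa) Rab) (U⊆R b y Uby))

isWeakOrder? : (R : BRel n) → Dec (IsWeakOrder R)
isWeakOrder? R =
  (all? λ a → all? λ b → all? λ c → R ∋?⟨ a , b ⟩ →-dec (R ∋?⟨ b , c ⟩ →-dec R ∋?⟨ a , c ⟩)) ×-dec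
  (all? λ a → all? λ b → R ∋?⟨ a , b ⟩ ⊎-dec R ∋?⟨ b , a ⟩)

isWeak2Order? : (R : BRel n) → Dec (IsWeak2Order R)
isWeak2Order? R = isWeakOrder? R ×-dec
  (any? λ a → any? λ b → ¬? (indiff? a b) ×-dec all? λ c → indiff? c a ⊎-dec indiff? c b)
  where indiff? = λ a b → R ∋?⟨ a , b ⟩ ×-dec R ∋?⟨ b , a ⟩

record J (W U : BRel n) : Set where
  constructor _,_
  field
    weak2    : IsWeak2Order U
    contains : W ⊆ᴿ U

J? : (W : BRel n) → Decidable (J W)
J? W U = map′ (λ (u₂ , W⊆U) → u₂ , W⊆U) (λ (u₂ , W⊆U) → u₂ , W⊆U) (isWeak2Order? U ×-dec W ⊆? U)

J-antitone : R ⊆ᴿ S → J S U → J R U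
J-antitone R⊆S (U₂ , S⊆U) = U₂ , λ a b → S⊆U a b ∘ R⊆S a b

cut? : (W : BRel n) (y : Fin n) → ∀ a b → Dec (W ∋⟨ a , y ⟩ ⊎ ¬ W ∋⟨ b , y ⟩)
cut? W y a b = W ∋?⟨ a , y ⟩ ⊎-dec ¬? (W ∋?⟨ b , y ⟩)

cut : BRel n → Fin n → BRel n
cut W y = fromPred (cut? W y)

module _ (W : BRel n) (wW : IsWeakOrder W) {x y : Fin n} (¬Wxy : ¬ W ∋⟨ x , y ⟩) where
  private
    module W = WeakOrder W wW
    C? = cut? W y

  cut-excludes : ¬ cut W y ∋⟨ x , y ⟩
  cut-excludes Cxy = [ ¬Wxy , (λ ¬Wyy → ¬Wyy W.reflexive) ]′ (∋-fromPred⁻ C? Cxy)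

  cut∈J : J W (cut W y)
  cut∈J = ((C-trans , C-total) , y , x , (λ (_ , Cxy) → cut-excludes Cxy) , classes) , W⊆C
    where
      C-trans : Transitiveᴿ (cut W y)
      C-trans a b c Cab Cbc with ∋-fromPred⁻ C? Cab | ∋-fromPred⁻ C? Cbc
      ... | inj₁ Way  | _         = ∋-fromPred⁺ C? (inj₁ Way)
      ... | inj₂ _    | inj₂ ¬Wcy = ∋-fromPred⁺ C? (inj₂ ¬Wcy)
      ... | inj₂ ¬Wby | inj₁ Wby  = ⊥-elim (¬Wby Wby)

      C-total : ∀ a b → cut W y ∋⟨ a , b ⟩ ⊎ cut W y ∋⟨ b , a ⟩
      C-total a b with W ∋?⟨ a , y ⟩
      ... | yes Way = inj₁ (∋-fromPred⁺ C? (inj₁ Way))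
      ... | no ¬Way = inj₂ (∋-fromPred⁺ C? (inj₂ ¬Way))

      classes : ∀ z → Indiff (cut W y) z y ⊎ Indiff (cut W y) z x
      classes z with W ∋?⟨ z , y ⟩
      ... | yes Wzy = inj₁ (∋-fromPred⁺ C? (inj₁ Wzy) , ∋-fromPred⁺ C? (inj₁ W.reflexive))
      ... | no ¬Wzy = inj₂ (∋-fromPred⁺ C? (inj₂ ¬Wxy) , ∋-fromPred⁺ C? (inj₂ ¬Wzy))

      W⊆C : W ⊆ᴿ cut W y
      W⊆C a b Wab with W ∋?⟨ a , y ⟩
      ... | yes Way = ∋-fromPred⁺ C? (inj₁ Way)
      ... | no ¬Way = ∋-fromPred⁺ C? (inj₂ λ Wby → ¬Way (W.trans Wab Wby))

J⊆J⇒⊇ : (R S : BRel n) → IsWeakOrder R → (∀ {U} → J R U → J S U) → S ⊆ᴿ R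
J⊆J⇒⊇ R S wR J⊆J x y Sxy = decidable-stable (R ∋?⟨ x , y ⟩) λ ¬Rxy →
  cut-excludes R wR ¬Rxy (J.contains (J⊆J (cut∈J R wR ¬Rxy)) x y Sxy)

J-injective : (R S : BRel n) → IsWeakOrder R → IsWeakOrder S →
              (∀ {U} → J R U → J S U) → (∀ {U} → J S U → J R U) → R ≡ S
J-injective R S wR wS J⊆J J⊇J = ⊆-antisym (J⊆J⇒⊇ S R wS J⊇J) (J⊆J⇒⊇ R S wR J⊆J)

-- Take a strict pair (x₀ , y₀) of u, then x W-least with ¬ u x y₀ and y W-greatest with ¬ u x₀ y:
-- a U ⊇ W omitting (x , y) omits every pair that u omits, so it is u by maximality.
isolatingPair : (W : BRel n) → IsWeakOrder W → IsWeak2Order u →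
                ∃₂ λ x y → ¬ u ∋⟨ x , y ⟩ × (∀ {U} → J W U → ¬ U ∋⟨ x , y ⟩ → U ≡ u)
isolatingPair {u = u} W wW u₂ with Weak2Order.strictPair u u₂
... | x₀ , y₀ , ¬ux₀y₀
  with leastFin (λ _ _ _ → W.trans) W.total
                (λ a → ¬? (u ∋?⟨ a , y₀ ⟩)) (x₀ , ¬ux₀y₀)
     | leastFin (λ _ _ _ ba cb → W.trans cb ba) (λ a b → W.total b a)
                (λ b → ¬? (u ∋?⟨ x₀ , b ⟩)) (y₀ , ¬ux₀y₀)
  where module W = WeakOrder W wW
... | x , ¬uxy₀ , x-least | y , ¬ux₀y , y-greatest = x , y , ¬uxy , isolated
  where
    module u = Weak2Order u u₂

    ¬uxy : ¬ u ∋⟨ x , y ⟩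
    ¬uxy = u.strict-combine ¬uxy₀ ¬ux₀y

    isolated : J W U → ¬ U ∋⟨ x , y ⟩ → U ≡ u
    isolated {U} (U₂ , W⊆U) ¬Uxy = Weak2Order.maximal U U₂ (proj₁ u₂) ¬uxy U⊆u
      where
        module U = WeakOrder U (proj₁ U₂)

        U⊆u : U ⊆ᴿ u
        U⊆u a b Uab = decidable-stable (u ∋?⟨ a , b ⟩) λ ¬uab →
          ¬Uxy (U.trans (U.trans (W⊆U x a (x-least a (u.strict-swapˡ ¬ux₀y₀ ¬uab))) Uab)
                        (W⊆U b y (y-greatest b (u.strict-swapʳ ¬ux₀y₀ ¬uab))))

record CutRemoved (W u V : BRel n) : Set where
  field
    removed∈J : J W u
    J⁻        : ∀ {U} → J V U → J W U × U ≢ u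
    J⁺        : ∀ {U} → J W U → U ≢ u → J V U

removeCut : (W : BRel n) → IsWeakOrder W → J W u → ∃ λ V → IsWeakOrder V × CutRemoved W u V
removeCut {n} {u = u} W wW u∈J = W⁺ , wW⁺ , record { removed∈J = u∈J ; J⁻ = J⁻ ; J⁺ = J⁺ }
  where
    Others? : Decidable λ U → J W U × U ≢ u
    Others? U = J? W U ×-dec ¬? (U ≟ᴿ u)

    W⁺ : BRel n
    W⁺ = ⋂ Others?

    W⊆W⁺ : W ⊆ᴿ W⁺
    W⊆W⁺ a b Wab = ∋-⋂⁺ Others? λ (JWU , _) → J.contains JWU a b Wab

    wW⁺ : IsWeakOrder W⁺
    wW⁺ = transitive⊇weakOrder W W⁺ wW W⊆W⁺ (⋂-transitive Others? (proj₁ ∘ proj₁ ∘ J.weak2 ∘ proj₁))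

    J⁻ : J W⁺ U → J W U × U ≢ u
    J⁻ JW⁺U@(_ , W⁺⊆U) = J-antitone W⊆W⁺ JW⁺U , λ { refl →
      let x , y , ¬uxy , isolated = isolatingPair W wW (J.weak2 u∈J)
      in ¬uxy (W⁺⊆U x y (∋-⋂⁺ Others? λ {U'} (JWU' , U'≢u) →
           decidable-stable (U' ∋?⟨ x , y ⟩) λ ¬U'xy → U'≢u (isolated JWU' ¬U'xy))) }

    J⁺ : J W U → U ≢ u → J W⁺ U
    J⁺ JWU U≢u = J.weak2 JWU , λ a b W⁺ab → ∋-⋂⁻ Others? W⁺ab (JWU , U≢u)

cutRemoved⇒covers : (W V : BRel n) → IsWeakOrder W → IsWeakOrder V → CutRemoved W u V → Covers V W
cutRemoved⇒covers {u = u} W V wW wV cr = W⊆V , W≢V , between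
  where
    open CutRemoved cr

    W⊆V : W ⊆ᴿ V
    W⊆V = J⊆J⇒⊇ V W wV (proj₁ ∘ J⁻)

    W≢V : W ≢ V
    W≢V refl = proj₂ (J⁻ removed∈J) refl

    between : ∀ Z → IsWeakOrder Z → W ⊆ᴿ Z → Z ⊆ᴿ V → Z ≡ W ⊎ Z ≡ V
    between Z wZ W⊆Z Z⊆V with Z ⊆? u
    ... | yes Z⊆u = inj₁ (J-injective Z W wZ wW (J-antitone W⊆Z) λ {U} JWU → case U ≟ᴿ u of λ
                      { (yes refl) → J.weak2 JWU , Z⊆u
                      ; (no U≢u)   → J-antitone Z⊆V (J⁺ JWU U≢u) })
    ... | no Z⊈u = inj₂ (J-injective Z V wZ wV
                      (λ JZU → J⁺ (J-antitone W⊆Z JZU) λ { refl → Z⊈u (J.contains JZU) })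
                      (J-antitone Z⊆V))

covers⇒cutRemoved : (W V : BRel n) → IsWeakOrder W → IsWeakOrder V →
                    Covers V W → ∃ λ u → CutRemoved W u V
covers⇒cutRemoved W V wW wV (W⊆V , W≢V , between) with ∃ᴿ? (λ U → J? W U ×-dec ¬? (V ⊆? U))
... | no ∄ = ⊥-elim (W≢V (J-injective W V wW wV J⊆J (J-antitone W⊆V)))
  where
    J⊆J : J W U → J V U
    J⊆J {U} JWU = J.weak2 JWU , decidable-stable (V ⊆? U) λ V⊈U → ∄ (U , JWU , V⊈U)
... | yes (u , u∈J , V⊈u) with removeCut W wW u∈J
...   | V₁ , wV₁ , cr = u , subst (CutRemoved W u) V₁≡V cr
  where
    open CutRemoved cr

    V₁≡V : V₁ ≡ V
    V₁≡V with between V₁ wV₁ (J⊆J⇒⊇ V₁ W wV₁ (proj₁ ∘ J⁻))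
                (J⊆J⇒⊇ V V₁ wV λ JVU → J⁺ (J-antitone W⊆V JVU) λ { refl → V⊈u (J.contains JVU) })
    ... | inj₁ refl = ⊥-elim (proj₂ (J⁻ u∈J) refl)
    ... | inj₂ V₁≡V = V₁≡V

-- If U ⊇ W ∩ u omits a pair (x , y) of W, then U contains u, hence equals it by maximality.
W∩u⊆U⇒W⊆U : (W : BRel n) → IsWeakOrder W → IsWeak2Order u →
             (∀ {a b} → ¬ u ∋⟨ a , b ⟩ → W ∋⟨ b , a ⟩) → IsWeak2Order U →
             (∀ {a b} → W ∋⟨ a , b ⟩ → u ∋⟨ a , b ⟩ → U ∋⟨ a , b ⟩) → U ≢ u → W ⊆ᴿ U
W∩u⊆U⇒W⊆U {u = u} {U = U} W wW u₂ W-reverses U₂ W∩u⊆U U≢u x y Wxy =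
  decidable-stable (U ∋?⟨ x , y ⟩) λ ¬Uxy →
    U≢u (sym (Weak2Order.maximal u u₂ (proj₁ U₂) ¬Uxy (u⊆U ¬Uxy)))
  where
    module W = WeakOrder W wW
    module u = Weak2Order u u₂
    module U = Weak2Order U U₂

    u⊆U : ¬ U ∋⟨ x , y ⟩ → u ⊆ᴿ U
    u⊆U ¬Uxy a b uab = decidable-stable (U ∋?⟨ a , b ⟩) λ ¬Uab →
      case u ∋?⟨ x , a ⟩ of λ
        { (no ¬uxa) → U.strict-swapˡ ¬Uxy ¬Uab
            (W∩u⊆U (W.trans (W-reverses ¬uxa) Wxy)
                   (decidable-stable (u ∋?⟨ a , y ⟩) (u.no-strict-chain ¬uxa)))
        ; (yes uxa) →
            let ¬uby = λ uby → ¬Uxy (W∩u⊆U Wxy (u.trans (u.trans uxa uab) uby))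
            in U.strict-swapʳ ¬Uxy ¬Uab
                 (W∩u⊆U (W.trans Wxy (W-reverses ¬uby))
                        (decidable-stable (u ∋?⟨ x , b ⟩) λ ¬uxb → u.no-strict-chain ¬uxb ¬uby)) }

addCut : (W W' : BRel n) → IsWeakOrder W → IsWeakOrder W' → W' ⊆ᴿ W →
         J W' u → ¬ W ⊆ᴿ u → ∃ λ V → IsWeakOrder V × CutRemoved V u W
addCut {n} {u} W W' wW wW' W'⊆W (u₂ , W'⊆u) W⊈u =
  W∩u , wW∩u , record { removed∈J = u₂ , W∩u⊆u ; J⁻ = J⁻ ; J⁺ = J⁺ }
  where
    module W = WeakOrder W wW
    module u = Weak2Order u u₂

    W∩u? = λ a b → W ∋?⟨ a , b ⟩ ×-dec u ∋?⟨ a , b ⟩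

    W∩u : BRel n
    W∩u = fromPred W∩u?

    W∩u⊆W : W∩u ⊆ᴿ W
    W∩u⊆W a b = proj₁ ∘ ∋-fromPred⁻ W∩u?

    W∩u⊆u : W∩u ⊆ᴿ u
    W∩u⊆u a b = proj₂ ∘ ∋-fromPred⁻ W∩u?

    wW∩u : IsWeakOrder W∩u
    wW∩u = transitive⊇weakOrder W' W∩u wW'
      (λ a b W'ab → ∋-fromPred⁺ W∩u? (W'⊆W a b W'ab , W'⊆u a b W'ab))
      (λ a b c ab bc → ∋-fromPred⁺ W∩u? (W.trans (W∩u⊆W a b ab) (W∩u⊆W b c bc) ,
                                         u.trans (W∩u⊆u a b ab) (W∩u⊆u b c bc)))

    J⁻ : J W U → J W∩u U × U ≢ u
    J⁻ JWU = J-antitone W∩u⊆W JWU , λ { refl → W⊈u (J.contains JWU) }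

    J⁺ : J W∩u U → U ≢ u → J W U
    J⁺ (U₂ , W∩u⊆U) U≢u = U₂ , W∩u⊆U⇒W⊆U W wW u₂
      (λ {a} {b} ¬uab → W'⊆W b a (WeakOrder.flip W' wW' (¬uab ∘ W'⊆u a b)))
      U₂ (λ {a} {b} Wab uab → W∩u⊆U a b (∋-fromPred⁺ W∩u? (Wab , uab))) U≢u

inSymDiffJ? : (W W' : BRel n) → Decidable (InSymDiffJ W W')
inSymDiffJ? W W' U = isWeak2Order? U ×-dec
  ((W ⊆? U ×-dec ¬? (W' ⊆? U)) ⊎-dec (W' ⊆? U ×-dec ¬? (W ⊆? U)))

inSymDiffJ-transfer : ∀ W' → (J R U → J S U) → (J S U → J R U) →
                      InSymDiffJ R W' U → InSymDiffJ S W' U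
inSymDiffJ-transfer _ R⇒S _ (U₂ , inj₁ (R⊆U , W'⊈U)) =
  U₂ , inj₁ (J.contains (R⇒S (U₂ , R⊆U)) , W'⊈U)
inSymDiffJ-transfer _ _ S⇒R (U₂ , inj₂ (W'⊆U , R⊈U)) =
  U₂ , inj₂ (W'⊆U , λ S⊆U → R⊈U (J.contains (S⇒R (U₂ , S⊆U))))

dJ : BRel n → BRel n → ℕ
dJ W W' = count (inSymDiffJ? W W') allRelations

HasCard-count : {P : BRel n → Set} (P? : Decidable P) → HasCard P (count P? allRelations)
HasCard-count P? =
  filter P? allRelations , filter⁺ P? allRelations⁺ ,
  (λ U → mk⇔ (proj₂ ∘ ∈-filter⁻ P? {xs = allRelations}) (∈-filter⁺ P? (∈-allRelations U))) , refl

module _ {W u V : BRel n} (cr : CutRemoved W u V) where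
  open CutRemoved cr

  private
    symDiff-off-u : ∀ W' → U ≢ u → InSymDiffJ W W' U ⇔ InSymDiffJ V W' U
    symDiff-off-u W' U≢u = mk⇔ (inSymDiffJ-transfer W' (λ JWU → J⁺ JWU U≢u) (proj₁ ∘ J⁻))
                               (inSymDiffJ-transfer W' (proj₁ ∘ J⁻) (λ JWU → J⁺ JWU U≢u))

    V⊈u : ¬ V ⊆ᴿ u
    V⊈u V⊆u = proj₂ (J⁻ (J.weak2 removed∈J , V⊆u)) refl

  dJ-removeCut : ∀ W' → ¬ W' ⊆ᴿ u → dJ W W' ≡ suc (dJ V W')
  dJ-removeCut W' W'⊈u =
    count-toggle (inSymDiffJ? W W') (inSymDiffJ? V W') allRelations⁺ (∈-allRelations u)
      (J.weak2 removed∈J , inj₁ (J.contains removed∈J , W'⊈u))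
      (λ { (_ , inj₁ (V⊆u , _)) → V⊈u V⊆u ; (_ , inj₂ (W'⊆u , _)) → W'⊈u W'⊆u })
      (symDiff-off-u W')

  dJ-addCut : ∀ W' → W' ⊆ᴿ u → dJ V W' ≡ suc (dJ W W')
  dJ-addCut W' W'⊆u =
    count-toggle (inSymDiffJ? V W') (inSymDiffJ? W W') allRelations⁺ (∈-allRelations u)
      (J.weak2 removed∈J , inj₂ (W'⊆u , V⊈u))
      (λ { (_ , inj₁ (_ , W'⊈u)) → W'⊈u W'⊆u ; (_ , inj₂ (_ , W⊈u)) → W⊈u (J.contains removed∈J) })
      (⇔.sym ∘ symDiff-off-u W')

  dJ-cutRemoved : ∀ W' → dJ W W' ≡ suc (dJ V W') ⊎ dJ V W' ≡ suc (dJ W W')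
  dJ-cutRemoved W' with W' ⊆? u
  ... | yes W'⊆u = inj₂ (dJ-addCut W' W'⊆u)
  ... | no W'⊈u = inj₁ (dJ-removeCut W' W'⊈u)

dJ-adjacent : Adj W V → ∀ W' → dJ W W' ≡ suc (dJ V W') ⊎ dJ V W' ≡ suc (dJ W W')
dJ-adjacent {W = W} {V} (wW , wV , inj₁ V⋗W) = dJ-cutRemoved (proj₂ (covers⇒cutRemoved W V wW wV V⋗W))
dJ-adjacent {W = W} {V} (wW , wV , inj₂ W⋗V) =
  Sum.swap ∘ dJ-cutRemoved (proj₂ (covers⇒cutRemoved V W wV wW W⋗V))

walk⇒dJ≤ : Walk W W' k → dJ W W' ≤ k
walk⇒dJ≤ {W = W} [] = ≤-reflexive (count-none (inSymDiffJ? W W) W∉J△J allRelations)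
  where
    W∉J△J : ∀ U → ¬ InSymDiffJ W W U
    W∉J△J U (_ , inj₁ (W⊆U , W⊈U)) = W⊈U W⊆U
    W∉J△J U (_ , inj₂ (W⊆U , W⊈U)) = W⊈U W⊆U
walk⇒dJ≤ {W' = W'} (adj ∷ walk) with dJ-adjacent adj W' | walk⇒dJ≤ walk
... | inj₁ d≡1+d′ | d′≤k = ≤-trans (≤-reflexive d≡1+d′) (s≤s d′≤k)
... | inj₂ d′≡1+d | d′≤k = m<n⇒m≤1+n (≤-trans (≤-reflexive (sym d′≡1+d)) d′≤k)

dJ≡0⇒≡ : (W W' : BRel n) → IsWeakOrder W → IsWeakOrder W' → dJ W W' ≡ 0 → W ≡ W'
dJ≡0⇒≡ W W' wW wW' d≡0 = J-injective W W' wW wW'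
  (λ {U} (U₂ , W⊆U) → U₂ , decidable-stable (W' ⊆? U) λ W'⊈U →
     count≡0⇒¬ (inSymDiffJ? W W') d≡0 (∈-allRelations U) (U₂ , inj₁ (W⊆U , W'⊈U)))
  (λ {U} (U₂ , W'⊆U) → U₂ , decidable-stable (W ⊆? U) λ W⊈U →
     count≡0⇒¬ (inSymDiffJ? W W') d≡0 (∈-allRelations U) (U₂ , inj₂ (W'⊆U , W⊈U)))

-- Remove a cut of W missing from J W' if there is one; otherwise J W ⊆ J W' and a cut can be added.
stepTowards : (W W' : BRel n) → IsWeakOrder W → IsWeakOrder W' → ∃ (InSymDiffJ W W') →
              ∃ λ V → Adj W V × dJ W W' ≡ suc (dJ V W')
stepTowards W W' wW wW' (U₀ , U₀₂ , U₀∈J△J) with ∃ᴿ? (λ U → J? W U ×-dec ¬? (W' ⊆? U))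
... | yes (u , u∈J , W'⊈u) =
  let V , wV , cr = removeCut W wW u∈J
  in V , (wW , wV , inj₁ (cutRemoved⇒covers W V wW wV cr)) , dJ-removeCut cr W' W'⊈u
... | no ∄ with U₀∈J△J
...   | inj₁ (W⊆U₀ , W'⊈U₀) = ⊥-elim (∄ (U₀ , (U₀₂ , W⊆U₀) , W'⊈U₀))
...   | inj₂ (W'⊆U₀ , W⊈U₀) =
  let V , wV , cr = addCut {u = U₀} W W' wW wW' (J⊆J⇒⊇ W W' wW J⊆J) (U₀₂ , W'⊆U₀) W⊈U₀
  in V , (wW , wV , inj₂ (cutRemoved⇒covers V W wV wW cr)) , dJ-addCut cr W' W'⊆U₀
  where
    J⊆J : J W U → J W' U
    J⊆J {U} JWU = J.weak2 JWU , decidable-stable (W' ⊆? U) λ W'⊈U → ∄ (U , JWU , W'⊈U)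

dJ⇒walk : (W W' : BRel n) → IsWeakOrder W → IsWeakOrder W' → dJ W W' ≡ k → Walk W W' k
dJ⇒walk {k = zero} W W' wW wW' d≡0 = subst (λ V → Walk W V 0) (dJ≡0⇒≡ W W' wW wW' d≡0) []
dJ⇒walk {k = suc k} W W' wW wW' d≡1+k =
  let J△J≢∅ = count≡suc⇒∃ (inSymDiffJ? W W') allRelations d≡1+k
      V , adj@(_ , wV , _) , d≡1+d′ = stepTowards W W' wW wW' J△J≢∅
  in adj ∷ dJ⇒walk V W' wV wW' (suc-injective (≡.trans (sym d≡1+d′) d≡1+k))

-- The argument works for every n.
mainTheorem7 : (n : ℕ) → 1 < n → (W W' : BRel n) → IsWeakOrder W → IsWeakOrder W' →
    ∃ λ d → IsDistance W W' d × HasCard (InSymDiffJ W W') d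
mainTheorem7 n _ W W' wW wW' =
  dJ W W' , (dJ⇒walk W W' wW wW' refl , λ _ → walk⇒dJ≤) , HasCard-count (inSymDiffJ? W W')
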